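{- Let $A$ and $B$ be commutative unitary rings such that $A$ is a subring of $B$. Then $\ell_A\le\ell_B$.
   Context: For a commutative unitary ring $C$ and $a_1,\dots,a_n\in C$, set $M_n(a_1,\ldots,a_n)=\begin{pmatrix} a_n & -1_C\\ 1_C & 0_C\end{pmatrix}\cdots\begin{pmatrix} a_1 & -1_C\\ 1_C & 0_C\end{pmatrix}$. An $n$-tuple $(a_1,\dots,a_n)\in C^n$ is a $\lambda$-quiddity over $C$ if $M_n(a_1,\dots,a_n)=\pm\mathrm{Id}$. Define $(a_1,\dots,a_n)\oplus(b_1,\dots,b_m)=(a_1+b_m,a_2,\dots,a_{n-1},a_n+b_1,b_2,\dots,b_{m-1})$. Write $\sim$ for equivalence of tuples up to cyclic rotation and reversal. A $\lambda$-quiddity $(c_1,\dots,c_n)$ over $C$ with $n\ge3$ is reducible if $(c_1,\dots,c_n)\sim(a_1,\dots,a_m)\oplus(b_1,\dots,b_l)$ for some $(a_1,\dots,a_m)\in C^m$ and some $\lambda$-quiddity $(b_1,\dots,b_l)$ over $C$, with $m,l\ge3$. It is irreducible otherwise; $(0_C,0_C)$ is not considered irreducible. $\ell_C\in\mathbb{N}\cup\{+\infty\}$ denotes the maximum size of an irreducible $\lambda$-quiddity over $C$. -}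

module Defs where

open import Level using (Level; _⊔_)
open import Algebra.Bundles using (CommutativeRing)
open import Data.Nat using (ℕ; _≤_)
open import Data.List using (List; []; _∷_; _++_; length; reverse; drop; take)
open import Data.List.Relation.Binary.Pointwise using (Pointwise)
open import Data.Product using (Σ; ∃; _×_)
open import Data.Sum using (_⊎_)
open import Relation.Nullary using (¬_)

module _ {c ℓ : Level} (R : CommutativeRing c ℓ) where
  open CommutativeRing R

  record Mat : Set c where
    constructor mat
    field
      m11 m12 m21 m22 : Carrier

  _·_ : Mat → Mat → Mat
  mat a b c' d · mat e f g h =
    mat (a * e + b * g) (a * f + b * h) (c' * e + d * g) (c' * f + d * h)

  IdM : Mat
  IdM = mat 1# 0# 0# 1#

  _≈M_ : Mat → Mat → Set ℓ
  mat a b c' d ≈M mat e f g h = (a ≈ e) × (b ≈ f) × (c' ≈ g) × (d ≈ h)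

  elemM : Carrier → Mat
  elemM a = mat a (- 1#) 1# 0#

  Mn : List Carrier → Mat
  Mn []       = IdM
  Mn (a ∷ as) = Mn as · elemM a

  IsLambdaQuiddity : List Carrier → Set ℓ
  IsLambdaQuiddity cs = (Mn cs ≈M IdM) ⊎ (Mn cs ≈M mat (- 1#) 0# 0# (- 1#))

  lastOr : Carrier → List Carrier → Carrier
  lastOr d []       = d
  lastOr d (x ∷ xs) = lastOr x xs

  initL : List Carrier → List Carrier
  initL []           = []
  initL (x ∷ [])     = []
  initL (x ∷ y ∷ ys) = x ∷ initL (y ∷ ys)

  -- (a_1..a_n) ⊕ (b_1..b_m) = (a_1+b_m, a_2, .., a_{n-1}, a_n+b_1, b_2, .., b_{m-1})
  -- (only used for n, m ≥ 3; junk value on empty input)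
  _⊕_ : List Carrier → List Carrier → List Carrier
  (a₁ ∷ as) ⊕ (b₁ ∷ bs) = (a₁ + lastOr b₁ bs) ∷ (initL as ++ ((lastOr a₁ as + b₁) ∷ initL bs))
  _ ⊕ _ = []

  rotate : ℕ → List Carrier → List Carrier
  rotate k xs = drop k xs ++ take k xs

  _∼_ : List Carrier → List Carrier → Set (c ⊔ ℓ)
  xs ∼ ys = ∃ λ k → Pointwise _≈_ (rotate k xs) ys ⊎ Pointwise _≈_ (rotate k (reverse xs)) ys

  IsReducible : List Carrier → Set (c ⊔ ℓ)
  IsReducible cs = ∃ λ (as : List Carrier) → ∃ λ (bs : List Carrier) →
    (3 ≤ length as) × (3 ≤ length bs) × IsLambdaQuiddity bs × (cs ∼ (as ⊕ bs))

  IsIrreducible : List Carrier → Set (c ⊔ ℓ)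
  IsIrreducible cs = IsLambdaQuiddity cs × (3 ≤ length cs) × ¬ IsReducible cs

-- The monomorphism ι sends an irreducible λ-quiddity (c₁, …, cₙ) over A to (ι c₁, …, ι cₙ),
-- which is irreducible over B.  As ι commutes with Mₙ and is injective, it preserves and
-- reflects λ-quiddities.  For irreducibility, a decomposition ι(c) ∼ a ⊕ b over B already
-- lives over A: Mₗ(b) = E(bₗ) M E(b₁) = ±Id with M = M_{l-2}(b₂, …, b_{l-1}) forces
-- b₁ = -m₁₁m₁₂ and bₗ = m₂₁m₁₁, so the ends of b lie in ι(A) because its middle entries do,
-- and then a₁ and aₘ lie in ι(A) because a₁ + bₗ and aₘ + b₁ do.
module Submission where

open import Defs
open import Level using (Level; _⊔_)
open import Algebra.Bundles using (CommutativeRing)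
open import Algebra.Morphism.Structures using (IsRingMonomorphism)
open import Data.List using (List; []; _∷_; _++_; length; map; reverse; drop; take)
open import Data.List.Relation.Binary.Pointwise as Pointwise using (Pointwise; []; _∷_)
open import Data.List.Relation.Unary.All using (All; []; _∷_)
open import Data.List.Relation.Unary.All.Properties using (++⁺; ++⁻)
open import Data.Nat using (zero; suc; _≤_; s≤s)
open import Data.Nat.Properties using (≤-reflexive; <⇒≤)
open import Data.Product using (∃; _×_; _,_; proj₂)
open import Data.Sum using (_⊎_; inj₁; inj₂; [_,_]′) renaming (map to ⊎-map)
open import Function using (_∘_)
open import Relation.Binary.PropositionalEquality as ≡ using (_≡_)

module _ {a b r} {A : Set a} {B : Set b} {R : A → B → Set r} where

  drop⁺ : ∀ k {xs ys} → Pointwise R xs ys → Pointwise R (drop k xs) (drop k ys)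
  drop⁺ zero    rs       = rs
  drop⁺ (suc k) []       = []
  drop⁺ (suc k) (_ ∷ rs) = drop⁺ k rs

  take⁺ : ∀ k {xs ys} → Pointwise R xs ys → Pointwise R (take k xs) (take k ys)
  take⁺ zero    rs       = []
  take⁺ (suc k) []       = []
  take⁺ (suc k) (r ∷ rs) = r ∷ take⁺ k rs

module Quiddities {c ℓ : Level} (R : CommutativeRing c ℓ) where
  open CommutativeRing R
  open Mat
  open import Algebra.Properties.Ring ring using (-1*x≈-x; -‿distribˡ-*; -‿distribʳ-*)
  open import Algebra.Properties.Group +-group using (⁻¹-involutive; ⁻¹-injective; ε⁻¹≈ε; inverseˡ-unique; x∙y⁻¹≈ε⇒x≈y)
  open import Algebra.Solver.Ring.NaturalCoefficients.Default commutativeSemiring using (solve; _:+_; _:*_; _:=_)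
  open import Relation.Binary.Reasoning.Setoid setoid

  infixl 7 _⊙_
  infix  4 _≋_

  _⊙_ : Mat R → Mat R → Mat R
  _⊙_ = _·_ R

  _≋_ : Mat R → Mat R → Set ℓ
  _≋_ = _≈M_ R

  ≋-refl : ∀ {M} → M ≋ M
  ≋-refl = refl , refl , refl , refl

  ≋-sym : ∀ {M N} → M ≋ N → N ≋ M
  ≋-sym (e₁ , e₂ , e₃ , e₄) = sym e₁ , sym e₂ , sym e₃ , sym e₄

  ≋-trans : ∀ {M N O} → M ≋ N → N ≋ O → M ≋ O
  ≋-trans (e₁ , e₂ , e₃ , e₄) (f₁ , f₂ , f₃ , f₄) = trans e₁ f₁ , trans e₂ f₂ , trans e₃ f₃ , trans e₄ f₄

  ⊙-cong : ∀ {M M′ N N′} → M ≋ M′ → N ≋ N′ → M ⊙ N ≋ M′ ⊙ N′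
  ⊙-cong (e₁ , e₂ , e₃ , e₄) (f₁ , f₂ , f₃ , f₄) =
    +-cong (*-cong e₁ f₁) (*-cong e₂ f₃) , +-cong (*-cong e₁ f₂) (*-cong e₂ f₄) ,
    +-cong (*-cong e₃ f₁) (*-cong e₄ f₃) , +-cong (*-cong e₃ f₂) (*-cong e₄ f₄)

  ⊙-assoc : ∀ M N O → (M ⊙ N) ⊙ O ≋ M ⊙ (N ⊙ O)
  ⊙-assoc (mat m₁₁ m₁₂ m₂₁ m₂₂) N O =
    row m₁₁ m₁₂ _ _ _ _ _ _ , row m₁₁ m₁₂ _ _ _ _ _ _ , row m₂₁ m₂₂ _ _ _ _ _ _ , row m₂₁ m₂₂ _ _ _ _ _ _
    where
    row : ∀ x y n₁₁ n₁₂ n₂₁ n₂₂ o₁ o₂ →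
      (x * n₁₁ + y * n₂₁) * o₁ + (x * n₁₂ + y * n₂₂) * o₂ ≈ x * (n₁₁ * o₁ + n₁₂ * o₂) + y * (n₂₁ * o₁ + n₂₂ * o₂)
    row = solve 8 (λ x y n₁₁ n₁₂ n₂₁ n₂₂ o₁ o₂ →
      ((x :* n₁₁ :+ y :* n₂₁) :* o₁ :+ (x :* n₁₂ :+ y :* n₂₂) :* o₂)
        := (x :* (n₁₁ :* o₁ :+ n₁₂ :* o₂) :+ y :* (n₂₁ :* o₁ :+ n₂₂ :* o₂))) refl

  private
    1x+0y≈x : ∀ x y → 1# * x + 0# * y ≈ x
    1x+0y≈x x y = trans (+-cong (*-identityˡ x) (zeroˡ y)) (+-identityʳ x)

    0x+1y≈y : ∀ x y → 0# * x + 1# * y ≈ y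
    0x+1y≈y x y = trans (+-cong (zeroˡ x) (*-identityˡ y)) (+-identityˡ y)

    x1+y0≈x : ∀ x y → x * 1# + y * 0# ≈ x
    x1+y0≈x x y = trans (+-cong (*-identityʳ x) (zeroʳ y)) (+-identityʳ x)

    x0+y1≈y : ∀ x y → x * 0# + y * 1# ≈ y
    x0+y1≈y x y = trans (+-cong (zeroʳ x) (*-identityʳ y)) (+-identityˡ y)

    x[-1]+y0≈-x : ∀ x y → x * - 1# + y * 0# ≈ - x
    x[-1]+y0≈-x x y = trans (+-cong (trans (*-comm x (- 1#)) (-1*x≈-x x)) (zeroʳ y)) (+-identityʳ (- x))

  ⊙-identityˡ : ∀ M → IdM R ⊙ M ≋ M
  ⊙-identityˡ M = 1x+0y≈x _ _ , 1x+0y≈x _ _ , 0x+1y≈y _ _ , 0x+1y≈y _ _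

  ⊙-identityʳ : ∀ M → M ⊙ IdM R ≋ M
  ⊙-identityʳ M = x1+y0≈x _ _ , x0+y1≈y _ _ , x1+y0≈x _ _ , x0+y1≈y _ _

  elemM-⊙ : ∀ x M → elemM R x ⊙ M ≋ mat (x * m11 M - m21 M) (x * m12 M - m22 M) (m11 M) (m12 M)
  elemM-⊙ x M = +-congˡ (-1*x≈-x _) , +-congˡ (-1*x≈-x _) , 1x+0y≈x _ _ , 1x+0y≈x _ _

  ⊙-elemM : ∀ M y → M ⊙ elemM R y ≋ mat (m11 M * y + m12 M) (- m11 M) (m21 M * y + m22 M) (- m21 M)
  ⊙-elemM M y = +-congˡ (*-identityʳ _) , x[-1]+y0≈-x _ _ , +-congˡ (*-identityʳ _) , x[-1]+y0≈-x _ _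

  Mn-++ : ∀ xs ys → Mn R (xs ++ ys) ≋ Mn R ys ⊙ Mn R xs
  Mn-++ []       ys = ≋-sym (⊙-identityʳ (Mn R ys))
  Mn-++ (x ∷ xs) ys = ≋-trans (⊙-cong (Mn-++ xs ys) ≋-refl) (⊙-assoc (Mn R ys) (Mn R xs) (elemM R x))

  -x*-y≈x*y : ∀ x y → - x * - y ≈ x * y
  -x*-y≈x*y x y = begin
    - x * - y      ≈⟨ -‿distribˡ-* x (- y) ⟨
    - (x * - y)    ≈⟨ -‿cong (-‿distribʳ-* x y) ⟨
    - - (x * y)    ≈⟨ ⁻¹-involutive (x * y) ⟩
    x * y          ∎

  elemM-sandwich-ends : ∀ {x y ε} M → ε * ε ≈ 1# → (elemM R x ⊙ M) ⊙ elemM R y ≋ mat ε 0# 0# ε →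
    (y ≈ - (m11 M * m12 M)) × (x ≈ m21 M * m11 M)
  elemM-sandwich-ends {x} {y} {ε} M ε²≈1 h
    with ≋-trans (≋-sym (≋-trans (⊙-cong (elemM-⊙ x M) ≋-refl) (⊙-elemM _ y))) h
  ... | _ , e₁₂ , e₂₁ , e₂₂ = y≈-pq , x≈rp
    where
    p = m11 M
    q = m12 M
    r = m21 M

    p²≈1 : p * p ≈ 1#
    p²≈1 = begin
      p * p      ≈⟨ -x*-y≈x*y p p ⟨
      - p * - p  ≈⟨ *-cong e₂₂ e₂₂ ⟩
      ε * ε      ≈⟨ ε²≈1 ⟩
      1#         ∎

    ppy+pq≈0 : (p * p) * y + p * q ≈ 0#
    ppy+pq≈0 = begin
      (p * p) * y + p * q  ≈⟨ +-congʳ (*-assoc p p y) ⟩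
      p * (p * y) + p * q  ≈⟨ distribˡ p (p * y) q ⟨
      p * (p * y + q)      ≈⟨ *-congˡ e₂₁ ⟩
      p * 0#               ≈⟨ zeroʳ p ⟩
      0#                   ∎

    xp≈r : x * p ≈ r
    xp≈r = x∙y⁻¹≈ε⇒x≈y (x * p) r (⁻¹-injective (trans e₁₂ (sym ε⁻¹≈ε)))

    y≈-pq : y ≈ - (p * q)
    y≈-pq = begin
      y            ≈⟨ *-identityˡ y ⟨
      1# * y       ≈⟨ *-congʳ p²≈1 ⟨
      (p * p) * y  ≈⟨ inverseˡ-unique _ _ ppy+pq≈0 ⟩
      - (p * q)    ∎

    x≈rp : x ≈ r * p
    x≈rp = begin
      x            ≈⟨ *-identityʳ x ⟨
      x * 1#       ≈⟨ *-congˡ p²≈1 ⟨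
      x * (p * p)  ≈⟨ *-assoc x p p ⟨
      (x * p) * p  ≈⟨ *-congʳ xp≈r ⟩
      r * p        ∎

  IsLambdaQuiddity⇒scalar : ∀ xs → IsLambdaQuiddity R xs → ∃ λ ε → (ε * ε ≈ 1#) × (Mn R xs ≋ mat ε 0# 0# ε)
  IsLambdaQuiddity⇒scalar _ (inj₁ h) = 1# , *-identityˡ 1# , h
  IsLambdaQuiddity⇒scalar _ (inj₂ h) = - 1# , trans (-x*-y≈x*y 1# 1#) (*-identityˡ 1#) , h

  IsLambdaQuiddity-ends : ∀ b₁ mid bₗ → IsLambdaQuiddity R (b₁ ∷ mid ++ bₗ ∷ []) →
    (b₁ ≈ - (m11 (Mn R mid) * m12 (Mn R mid))) × (bₗ ≈ m21 (Mn R mid) * m11 (Mn R mid))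
  IsLambdaQuiddity-ends b₁ mid bₗ q with IsLambdaQuiddity⇒scalar (b₁ ∷ mid ++ bₗ ∷ []) q
  ... | ε , ε²≈1 , h = elemM-sandwich-ends (Mn R mid) ε²≈1 (≋-trans (≋-sym split) h)
    where
    split : Mn R (b₁ ∷ mid ++ bₗ ∷ []) ≋ (elemM R bₗ ⊙ Mn R mid) ⊙ elemM R b₁
    split = ⊙-cong (≋-trans (Mn-++ mid (bₗ ∷ [])) (⊙-cong (⊙-identityˡ (elemM R bₗ)) ≋-refl)) ≋-refl

  initL-++-lastOr : ∀ y ys → initL R (y ∷ ys) ++ lastOr R y ys ∷ [] ≡ y ∷ ys
  initL-++-lastOr y []       = ≡.refl
  initL-++-lastOr y (z ∷ zs) = ≡.cong (y ∷_) (initL-++-lastOr z zs)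

  All-initL-lastOr : ∀ {p} {P : Carrier → Set p} {y ys} → All P (initL R (y ∷ ys)) → P (lastOr R y ys) → All P (y ∷ ys)
  All-initL-lastOr {P = P} {y} {ys} ps p = ≡.subst (All P) (initL-++-lastOr y ys) (++⁺ ps (p ∷ []))

module RingMonomorphism {a ℓa b ℓb : Level} {A : CommutativeRing a ℓa} {B : CommutativeRing b ℓb}
  {ι : CommutativeRing.Carrier A → CommutativeRing.Carrier B}
  (mono : IsRingMonomorphism (CommutativeRing.rawRing A) (CommutativeRing.rawRing B) ι) where

  private module A = CommutativeRing A
  private module QA = Quiddities A
  open CommutativeRing B
  open IsRingMonomorphism mono
  open Quiddities B
  open Mat
  open import Algebra.Properties.AbelianGroup +-abelianGroup using (xyx⁻¹≈y)

  Image : Carrier → Set (a ⊔ ℓb)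
  Image y = ∃ λ x → ι x ≈ y

  Image-cong : ∀ {x y} → x ≈ y → Image x → Image y
  Image-cong x≈y (u , ιu≈x) = u , trans ιu≈x x≈y

  Image-+ : ∀ {x y} → Image x → Image y → Image (x + y)
  Image-+ (u , ιu≈x) (v , ιv≈y) = u A.+ v , trans (+-homo u v) (+-cong ιu≈x ιv≈y)

  Image-* : ∀ {x y} → Image x → Image y → Image (x * y)
  Image-* (u , ιu≈x) (v , ιv≈y) = u A.* v , trans (*-homo u v) (*-cong ιu≈x ιv≈y)

  Image-neg : ∀ {x} → Image x → Image (- x)
  Image-neg (u , ιu≈x) = A.- u , trans (-‿homo u) (-‿cong ιu≈x)

  Image-cancelʳ : ∀ {x y} → Image (x + y) → Image y → Image x
  Image-cancelʳ {x} {y} x+y y′ = Image-cong (trans (+-congʳ (+-comm x y)) (xyx⁻¹≈y y x)) (Image-+ x+y (Image-neg y′))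

  infix 4 _↦_

  _↦_ : List A.Carrier → List Carrier → Set (a ⊔ b ⊔ ℓb)
  _↦_ = Pointwise (λ x y → ι x ≈ y)

  ↦-map : ∀ xs → xs ↦ map ι xs
  ↦-map []       = []
  ↦-map (x ∷ xs) = refl ∷ ↦-map xs

  ↦-resp-≈ : ∀ {xs ys zs} → xs ↦ ys → Pointwise _≈_ ys zs → xs ↦ zs
  ↦-resp-≈ = Pointwise.transitive trans

  ↦-injective : ∀ {xs ys zs} → xs ↦ zs → ys ↦ zs → Pointwise A._≈_ xs ys
  ↦-injective []       []       = []
  ↦-injective (e ∷ es) (f ∷ fs) = injective (trans e (sym f)) ∷ ↦-injective es fs

  ↦⇒All-Image : ∀ {xs ys} → xs ↦ ys → All Image ys
  ↦⇒All-Image []       = []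
  ↦⇒All-Image (e ∷ es) = (_ , e) ∷ ↦⇒All-Image es

  All-Image⇒↦ : ∀ {ys} → All Image ys → ∃ λ xs → xs ↦ ys
  All-Image⇒↦ []              = [] , []
  All-Image⇒↦ ((x , e) ∷ ims) with All-Image⇒↦ ims
  ... | xs , es = x ∷ xs , e ∷ es

  ↦-rotate : ∀ k {xs ys} → xs ↦ ys → rotate A k xs ↦ rotate B k ys
  ↦-rotate k es = Pointwise.++⁺ (drop⁺ k es) (take⁺ k es)

  ↦-lastOr : ∀ {x y xs ys} → ι x ≈ y → xs ↦ ys → ι (lastOr A x xs) ≈ lastOr B y ys
  ↦-lastOr e []       = e
  ↦-lastOr _ (e ∷ es) = ↦-lastOr e es

  ↦-initL : ∀ {xs ys} → xs ↦ ys → initL A xs ↦ initL B ys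
  ↦-initL []           = []
  ↦-initL (_ ∷ [])     = []
  ↦-initL (e ∷ f ∷ es) = e ∷ ↦-initL (f ∷ es)

  ↦-⊕ : ∀ {as as′ bs bs′} → as ↦ as′ → bs ↦ bs′ → _⊕_ A as bs ↦ _⊕_ B as′ bs′
  ↦-⊕ []       _        = []
  ↦-⊕ (_ ∷ _)  []       = []
  ↦-⊕ (e ∷ es) (f ∷ fs) = ι-+ e (↦-lastOr f fs) ∷ Pointwise.++⁺ (↦-initL es) (ι-+ (↦-lastOr e es) f ∷ ↦-initL fs)
    where
    ι-+ : ∀ {x x′ y y′} → ι x ≈ x′ → ι y ≈ y′ → ι (x A.+ y) ≈ x′ + y′
    ι-+ e f = trans (+-homo _ _) (+-cong e f)

  ↦-∼ : ∀ {xs ys zs} → xs ↦ ys → _∼_ B ys zs → ∃ λ k → (rotate A k xs ↦ zs) ⊎ (rotate A k (reverse xs) ↦ zs)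
  ↦-∼ es (k , inj₁ ys≈zs) = k , inj₁ (↦-resp-≈ (↦-rotate k es) ys≈zs)
  ↦-∼ es (k , inj₂ ys≈zs) = k , inj₂ (↦-resp-≈ (↦-rotate k (Pointwise.reverse⁺ es)) ys≈zs)

  ∼-image : ∀ {xs ys zs} → xs ↦ ys → _∼_ B ys zs → All Image zs
  ∼-image es ys∼zs = [ ↦⇒All-Image , ↦⇒All-Image ]′ (proj₂ (↦-∼ es ys∼zs))

  ∼-reflect : ∀ {xs ys ws zs} → xs ↦ ys → ws ↦ zs → _∼_ B ys zs → _∼_ A xs ws
  ∼-reflect es fs ys∼zs with ↦-∼ es ys∼zs
  ... | k , inj₁ gs = k , inj₁ (↦-injective gs fs)
  ... | k , inj₂ gs = k , inj₂ (↦-injective gs fs)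

  mapMat : Mat A → Mat B
  mapMat (mat p q r s) = mat (ι p) (ι q) (ι r) (ι s)

  mapMat-⊙ : ∀ M N → mapMat M ⊙ mapMat N ≋ mapMat (M QA.⊙ N)
  mapMat-⊙ M N = ι-dot _ _ _ _ , ι-dot _ _ _ _ , ι-dot _ _ _ _ , ι-dot _ _ _ _
    where
    ι-dot : ∀ p q r s → ι p * ι r + ι q * ι s ≈ ι (p A.* r A.+ q A.* s)
    ι-dot p q r s = sym (trans (+-homo _ _) (+-cong (*-homo p r) (*-homo q s)))

  mapMat-cong : ∀ {M N} → M QA.≋ N → mapMat M ≋ mapMat N
  mapMat-cong (e₁ , e₂ , e₃ , e₄) = ⟦⟧-cong e₁ , ⟦⟧-cong e₂ , ⟦⟧-cong e₃ , ⟦⟧-cong e₄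

  mapMat-injective : ∀ {M N} → mapMat M ≋ mapMat N → M QA.≋ N
  mapMat-injective (e₁ , e₂ , e₃ , e₄) = injective e₁ , injective e₂ , injective e₃ , injective e₄

  mapMat-scalar : ∀ {x y} → ι x ≈ y → mapMat (mat x A.0# A.0# x) ≋ mat y 0# 0# y
  mapMat-scalar e = e , 0#-homo , 0#-homo , e

  ι[-1]≈-1 : ι (A.- A.1#) ≈ - 1#
  ι[-1]≈-1 = trans (-‿homo A.1#) (-‿cong 1#-homo)

  Mn-↦ : ∀ {xs ys} → xs ↦ ys → Mn B ys ≋ mapMat (Mn A xs)
  Mn-↦ []       = ≋-sym (mapMat-scalar 1#-homo)
  Mn-↦ (e ∷ es) = ≋-trans (⊙-cong (Mn-↦ es) (sym e , sym ι[-1]≈-1 , sym 1#-homo , sym 0#-homo)) (mapMat-⊙ _ _)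

  IsLambdaQuiddity-↦ : ∀ {xs ys} → xs ↦ ys → IsLambdaQuiddity A xs → IsLambdaQuiddity B ys
  IsLambdaQuiddity-↦ {xs} {ys} es = ⊎-map (scalar 1#-homo) (scalar ι[-1]≈-1)
    where
    scalar : ∀ {x y} → ι x ≈ y → Mn A xs QA.≋ mat x A.0# A.0# x → Mn B ys ≋ mat y 0# 0# y
    scalar e h = ≋-trans (Mn-↦ es) (≋-trans (mapMat-cong h) (mapMat-scalar e))

  IsLambdaQuiddity-↦⁻ : ∀ {xs ys} → xs ↦ ys → IsLambdaQuiddity B ys → IsLambdaQuiddity A xs
  IsLambdaQuiddity-↦⁻ {xs} {ys} es = ⊎-map (scalar 1#-homo) (scalar ι[-1]≈-1)
    where
    scalar : ∀ {x y} → ι x ≈ y → Mn B ys ≋ mat y 0# 0# y → Mn A xs QA.≋ mat x A.0# A.0# x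
    scalar e h = mapMat-injective (≋-trans (≋-sym (Mn-↦ es)) (≋-trans h (≋-sym (mapMat-scalar e))))

  IsLambdaQuiddity-ends-image : ∀ {b₁ mid bₗ} → IsLambdaQuiddity B (b₁ ∷ mid ++ bₗ ∷ []) → All Image mid →
    Image b₁ × Image bₗ
  IsLambdaQuiddity-ends-image {b₁} {mid} {bₗ} q ims with All-Image⇒↦ ims | IsLambdaQuiddity-ends b₁ mid bₗ q
  ... | mid′ , es | b₁≈-pq , bₗ≈rp with Mn-↦ es
  ... | p≈ , q≈ , r≈ , _ =
    Image-cong (sym b₁≈-pq) (Image-neg (Image-* (_ , sym p≈) (_ , sym q≈))) ,
    Image-cong (sym bₗ≈rp) (Image-* (_ , sym r≈) (_ , sym p≈))

  ⊕-image : ∀ {as bs} → 2 ≤ length as → 2 ≤ length bs → IsLambdaQuiddity B bs →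
    All Image (_⊕_ B as bs) → All Image as × All Image bs
  ⊕-image {[]}                 ()       _        _ _
  ⊕-image {_ ∷ []}             (s≤s ()) _        _ _
  ⊕-image {_ ∷ _ ∷ _} {[]}     _        ()       _ _
  ⊕-image {_ ∷ _ ∷ _} {_ ∷ []} _        (s≤s ()) _ _
  ⊕-image {a₁ ∷ u ∷ us} {b₁ ∷ y ∷ ys} _ _ q (im₁ ∷ ims) with ++⁻ (initL B (u ∷ us)) ims
  ... | ims-a , im₂ ∷ ims-b with IsLambdaQuiddity-ends-image q′ ims-b
    where
    q′ : IsLambdaQuiddity B (b₁ ∷ initL B (y ∷ ys) ++ lastOr B y ys ∷ [])
    q′ = ≡.subst (λ l → IsLambdaQuiddity B (b₁ ∷ l)) (≡.sym (initL-++-lastOr y ys)) q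
  ... | im-b₁ , im-bₗ =
    Image-cancelʳ im₁ im-bₗ ∷ All-initL-lastOr ims-a (Image-cancelʳ im₂ im-b₁) ,
    im-b₁ ∷ All-initL-lastOr ims-b im-bₗ

  IsReducible-↦⁻ : ∀ {xs ys} → xs ↦ ys → IsReducible B ys → IsReducible A xs
  IsReducible-↦⁻ es (as , bs , 3≤|as| , 3≤|bs| , q , ys∼as⊕bs)
    with ⊕-image (<⇒≤ 3≤|as|) (<⇒≤ 3≤|bs|) q (∼-image es ys∼as⊕bs)
  ... | ims-a , ims-b with All-Image⇒↦ ims-a | All-Image⇒↦ ims-b
  ... | as′ , fs | bs′ , gs =
    as′ , bs′ ,
    ≡.subst (3 ≤_) (≡.sym (Pointwise.Pointwise-length fs)) 3≤|as| ,
    ≡.subst (3 ≤_) (≡.sym (Pointwise.Pointwise-length gs)) 3≤|bs| ,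
    IsLambdaQuiddity-↦⁻ gs q , ∼-reflect es (↦-⊕ fs gs) ys∼as⊕bs

  IsIrreducible-↦ : ∀ {xs ys} → xs ↦ ys → IsIrreducible A xs → IsIrreducible B ys
  IsIrreducible-↦ es (q , 3≤|xs| , irreducible) =
    IsLambdaQuiddity-↦ es q , ≡.subst (3 ≤_) (Pointwise.Pointwise-length es) 3≤|xs| , irreducible ∘ IsReducible-↦⁻ es

proposition2p16 : {a ℓa b ℓb : Level} (A : CommutativeRing a ℓa) (B : CommutativeRing b ℓb)
    → (ι : CommutativeRing.Carrier A → CommutativeRing.Carrier B)
    → IsRingMonomorphism (CommutativeRing.rawRing A) (CommutativeRing.rawRing B) ι
    → (cs : List (CommutativeRing.Carrier A)) → IsIrreducible A cs
    → ∃ λ (ds : List (CommutativeRing.Carrier B)) → IsIrreducible B ds × (length cs ≤ length ds)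
proposition2p16 A B ι mono cs irreducible =
  map ι cs , IsIrreducible-↦ (↦-map cs) irreducible , ≤-reflexive (Pointwise.Pointwise-length (↦-map cs))
  where open RingMonomorphism mono
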